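{- Let $a,b,c\in\mathbb{N}$ with $a\equiv b\equiv 1 \pmod 2$ and $(a,b)=(b,c)=(a,c)=1$. Then $$s_{5}(a,c,b)+s_{5}(b,c,a)=\frac{1}{2}\sum_{r=1}^{c-1}(-1)^{[\frac{ar}{c}]+[\frac{br}{c}]}-\frac{c}{2ab}+\frac{1}{2},$$ where the sum on the right-hand side is interpreted as $0$ when $c=1$.
   Context: For $a,b,c\in\mathbb{Z}$ with $c\ne0$, $s_{5}(a,b,c)=\sum_{r=0}^{|c|-1}(-1)^{r+[\frac{ar}{c}]}\bigl(\bigl(\frac{br}{c}\bigr)\bigr)$, where $[x]$ is the floor of $x$, $\{x\}=x-[x]$, and $((x))=\{x\}-\frac12$ if $x\notin\mathbb{Z}$, $((x))=0$ if $x\in\mathbb{Z}$. $(a,b)$ denotes the greatest common divisor. -}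

module Defs where

open import Data.Nat as ℕ using (ℕ; zero; suc)
open import Data.Integer as ℤ using (ℤ; +_; -[1+_]; ∣_∣)
open import Data.Rational as ℚ using (ℚ; 0ℚ; 1ℚ; ½; floor; _/_)
open import Data.List using (List; map; foldr; upTo)
open import Data.Bool using (if_then_else_)
open import Relation.Nullary.Decidable using (does)

sumTo : ℕ → (ℕ → ℚ) → ℚ
sumTo n f = foldr ℚ._+_ 0ℚ (map f (upTo n))

-- the rational number n / c for integers n, c  (c ≠ 0; value for c = 0 is
-- irrelevant and set to 0)
ratio : ℤ → ℤ → ℚ
ratio n (+ zero)    = 0ℚ
ratio n (+ (suc k)) = n / suc k
ratio n -[1+ k ]    = (ℤ.- n) / suc k

frac : ℚ → ℚ
frac x = x ℚ.- (floor x / 1)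

saw : ℚ → ℚ
saw x = if does (frac x ℚ.≟ 0ℚ) then 0ℚ else frac x ℚ.- ½

negOnePow : ℤ → ℚ
negOnePow k = if (∣ k ∣ ℕ.% 2) ℕ.≡ᵇ 0 then 1ℚ else ℚ.- 1ℚ

s₅ : ℤ → ℤ → ℤ → ℚ
s₅ a b c = sumTo ∣ c ∣ λ r →
  negOnePow (+ r ℤ.+ floor (ratio (a ℤ.* + r) c)) ℚ.* saw (ratio (b ℤ.* + r) c)

module Submission where

-- Write F(x) = (-1)^([ax] + [bx]) and sample it on the grid x = s/(abc), i.e. consider
-- φ(s) = (-1)^(⌊s/bc⌋ + ⌊s/ac⌋).  φ changes sign exactly at the multiples of bc and of ac,
-- which never coincide below abc since a, b, c are pairwise coprime, and just after the
-- jumps at j·bc and k·ac it takes the values (-1)^(j+[bj/a]) and (-1)^(k+[ak/b]) that occur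
-- in s₅(b,c,a) and s₅(a,c,b).  Summation by parts of φ against the weight
-- w(s) = 2c⌊s/c⌋ - 2ab⌊s/ab⌋ + 2c - ab, which takes the value b·2a((cj/a)) just before the
-- jump at j·bc and a·2b((ck/b)) just before the jump at k·ac, turns the jump terms into
-- -4ab(s₅(a,c,b) + s₅(b,c,a)).  On the other side w only moves at the multiples of ab,
-- where φ gives the signs (-1)^([ar/c]+[br/c]) of the right-hand sum, and at the multiples
-- of c, where φ gives F(i/ab); the latter sum to 1 over a period by the Chinese remainder
-- theorem, a and b being odd.

open import Defs
open import Data.Nat as ℕ using (ℕ; zero; suc; pred; _+_; _∸_; _*_; _/_; _%_; _<_; _≤_; NonZero)
open import Data.Nat.GCD using (gcd)
open import Data.Integer as ℤ using (ℤ; +_; -[1+_]; 0ℤ; 1ℤ)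
open import Data.Rational as ℚ using (ℚ; ½; floor)
open import Relation.Binary.PropositionalEquality
  using (_≡_; _≢_; refl; sym; trans; cong; cong₂; subst; module ≡-Reasoning)

import Data.Nat.Properties as ℕP
import Data.Nat.DivMod as ℕD
open import Data.Nat.Divisibility as ℕDiv using (_∣_; _∣?_; divides)
open import Data.Nat.Coprimality as Coprimality using (Coprime; coprime-divisor; gcd≡1⇒coprime)
import Data.Nat.Tactic.RingSolver as ℕ-Solver
import Data.Integer.Properties as ℤP
open import Data.Integer.Tactic.RingSolver using (solve-∀)
open import Data.Rational.Unnormalised as ℚᵘ using (mkℚᵘ; *≡*)
import Data.Rational.Unnormalised.Properties as ℚᵘP
import Data.Rational.Properties as ℚP
open import Data.Rational.Solver using (module +-*-Solver)
open import Data.Fin as Fin using (Fin; toℕ; fromℕ<)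
import Data.Fin.Properties as FinP
open import Data.Fin.Permutation using (Permutation′; permutation)
open import Algebra.Properties.CommutativeMonoid.Sum ℤP.+-0-commutativeMonoid using (sum; sum-cong-≗; ∑-permute)
open import Data.List using (foldr; applyUpTo)
open import Data.List.Properties using (map-upTo)
open import Data.Bool using (if_then_else_)
open import Data.Product using (_×_; _,_; proj₁; proj₂; ∃)
open import Data.Sum using (_⊎_; inj₁; inj₂)
open import Function using (_∘_)
open import Relation.Nullary using (¬_; yes; no; contradiction)
open import Relation.Nullary.Decidable using (dec-true; dec-false)
open ≡-Reasoning

-- Finite sums

Σ : ℕ → (ℕ → ℤ) → ℤ
Σ zero    f = 0ℤ
Σ (suc n) f = Σ n f ℤ.+ f n

Σ-cong : ∀ n {f g : ℕ → ℤ} → (∀ {i} → i < n → f i ≡ g i) → Σ n f ≡ Σ n g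
Σ-cong zero    f≗g = refl
Σ-cong (suc n) f≗g = cong₂ ℤ._+_ (Σ-cong n (f≗g ∘ ℕP.m<n⇒m<1+n)) (f≗g ℕP.≤-refl)

Σ-head : ∀ n f → Σ (suc n) f ≡ f 0 ℤ.+ Σ n (f ∘ suc)
Σ-head zero    f = ℤP.+-comm 0ℤ (f 0)
Σ-head (suc n) f = begin
  Σ (suc n) f ℤ.+ f (suc n)               ≡⟨ cong (ℤ._+ f (suc n)) (Σ-head n f) ⟩
  f 0 ℤ.+ Σ n (f ∘ suc) ℤ.+ f (suc n)     ≡⟨ ℤP.+-assoc (f 0) (Σ n (f ∘ suc)) (f (suc n)) ⟩
  f 0 ℤ.+ Σ (suc n) (f ∘ suc)             ∎

Σ-zero : ∀ n → Σ n (λ _ → 0ℤ) ≡ 0ℤ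
Σ-zero zero    = refl
Σ-zero (suc n) = cong (ℤ._+ 0ℤ) (Σ-zero n)

Σ-distrib-+ : ∀ n f g → Σ n (λ i → f i ℤ.+ g i) ≡ Σ n f ℤ.+ Σ n g
Σ-distrib-+ zero    f g = refl
Σ-distrib-+ (suc n) f g = trans (cong (ℤ._+ (f n ℤ.+ g n)) (Σ-distrib-+ n f g))
                                (shuffle (Σ n f) (Σ n g) (f n) (g n))
  where
  shuffle : ∀ x y z t → x ℤ.+ y ℤ.+ (z ℤ.+ t) ≡ x ℤ.+ z ℤ.+ (y ℤ.+ t)
  shuffle = solve-∀

Σ-distribˡ-* : ∀ n k f → Σ n (λ i → k ℤ.* f i) ≡ k ℤ.* Σ n f
Σ-distribˡ-* zero    k f = sym (ℤP.*-zeroʳ k)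
Σ-distribˡ-* (suc n) k f = trans (cong (ℤ._+ k ℤ.* f n) (Σ-distribˡ-* n k f))
                                 (sym (ℤP.*-distribˡ-+ k (Σ n f) (f n)))

Σ-distribʳ-* : ∀ n k f → Σ n (λ i → f i ℤ.* k) ≡ Σ n f ℤ.* k
Σ-distribʳ-* zero    k f = refl
Σ-distribʳ-* (suc n) k f = trans (cong (ℤ._+ f n ℤ.* k) (Σ-distribʳ-* n k f))
                                 (sym (ℤP.*-distribʳ-+ k (Σ n f) (f n)))

Σ-linear : ∀ n x y f g → Σ n (λ i → x ℤ.* f i ℤ.- y ℤ.* g i) ≡ x ℤ.* Σ n f ℤ.- y ℤ.* Σ n g
Σ-linear zero    x y f g = sym (cong₂ ℤ._-_ (ℤP.*-zeroʳ x) (ℤP.*-zeroʳ y))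
Σ-linear (suc n) x y f g = trans (cong (ℤ._+ (x ℤ.* f n ℤ.- y ℤ.* g n)) (Σ-linear n x y f g))
                                 (regroup x y (Σ n f) (Σ n g) (f n) (g n))
  where
  regroup : ∀ x y F G u v → x ℤ.* F ℤ.- y ℤ.* G ℤ.+ (x ℤ.* u ℤ.- y ℤ.* v) ≡ x ℤ.* (F ℤ.+ u) ℤ.- y ℤ.* (G ℤ.+ v)
  regroup = solve-∀

Σ-+ : ∀ m n f → Σ (m + n) f ≡ Σ m f ℤ.+ Σ n (λ i → f (m + i))
Σ-+ m zero    f = trans (cong (λ k → Σ k f) (ℕP.+-identityʳ m)) (sym (ℤP.+-identityʳ (Σ m f)))
Σ-+ m (suc n) f = begin
  Σ (m + suc n) f                                ≡⟨ cong (λ k → Σ k f) (ℕP.+-suc m n) ⟩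
  Σ (m + n) f ℤ.+ f (m + n)                      ≡⟨ cong (ℤ._+ f (m + n)) (Σ-+ m n f) ⟩
  Σ m f ℤ.+ Σ n (λ i → f (m + i)) ℤ.+ f (m + n)  ≡⟨ ℤP.+-assoc (Σ m f) _ _ ⟩
  Σ m f ℤ.+ Σ (suc n) (λ i → f (m + i))          ∎

Σ-blocks : ∀ n m f → Σ (n * m) f ≡ Σ n (λ q → Σ m (λ x → f (x + q * m)))
Σ-blocks zero    m f = refl
Σ-blocks (suc n) m f = begin
  Σ (m + n * m) f                              ≡⟨ cong (λ k → Σ k f) (ℕP.+-comm m (n * m)) ⟩
  Σ (n * m + m) f                              ≡⟨ Σ-+ (n * m) m f ⟩
  Σ (n * m) f ℤ.+ Σ m (λ x → f (n * m + x))    ≡⟨ cong₂ ℤ._+_ (Σ-blocks n m f)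
                                                    (Σ-cong m (λ {x} _ → cong f (ℕP.+-comm (n * m) x))) ⟩
  Σ (suc n) (λ q → Σ m (λ x → f (x + q * m)))  ∎

Σ-comm : ∀ m n (f : ℕ → ℕ → ℤ) → Σ m (λ i → Σ n (f i)) ≡ Σ n (λ j → Σ m (λ i → f i j))
Σ-comm zero    n f = sym (Σ-zero n)
Σ-comm (suc m) n f = trans (cong (ℤ._+ Σ n (f m)) (Σ-comm m n f))
                           (sym (Σ-distrib-+ n (λ j → Σ m (λ i → f i j)) (f m)))

Σ≡sum : ∀ n g → Σ n g ≡ sum (λ (i : Fin n) → g (toℕ i))
Σ≡sum zero    g = refl
Σ≡sum (suc n) g = trans (Σ-head n g) (cong (ℤ._+_ (g 0)) (Σ≡sum n (g ∘ suc)))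

injective⇒surjective : ∀ {n} (f : Fin n → Fin n) → (∀ {i j} → f i ≡ f j → i ≡ j) →
                       ∀ y → ∃ λ x → f x ≡ y
injective⇒surjective {suc n} f f-inj y with FinP.any? (λ x → f x Fin.≟ y)
... | yes hit = hit
... | no miss = contradiction (FinP.injective⇒≤ skipY-injective) ℕP.1+n≰n
  where
  avoids : ∀ x → y ≢ f x
  avoids x y≡fx = miss (x , sym y≡fx)
  skipY : Fin (suc n) → Fin n
  skipY x = Fin.punchOut (avoids x)
  skipY-injective : ∀ {i j} → skipY i ≡ skipY j → i ≡ j
  skipY-injective eq = f-inj (FinP.punchOut-injective (avoids _) (avoids _) eq)

Σ-permute : ∀ n (h : ℕ → ℕ) → (∀ {i} → i < n → h i < n) →
            (∀ {i j} → i < n → j < n → h i ≡ h j → i ≡ j) →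
            ∀ g → Σ n (g ∘ h) ≡ Σ n g
Σ-permute n h h<n h-inj g = begin
  Σ n (g ∘ h)                     ≡⟨ Σ≡sum n (g ∘ h) ⟩
  sum {n} (λ i → g (h (toℕ i)))   ≡⟨ sum-cong-≗ {n} (λ i → cong g (sym (FinP.toℕ-fromℕ< _))) ⟩
  sum {n} (λ i → g (toℕ (hᶠ i)))  ≡⟨ sym (∑-permute (g ∘ toℕ) π) ⟩
  sum {n} (λ i → g (toℕ i))       ≡⟨ sym (Σ≡sum n g) ⟩
  Σ n g                           ∎
  where
  hᶠ : Fin n → Fin n
  hᶠ i = fromℕ< (h<n (FinP.toℕ<n i))
  hᶠ-injective : ∀ {i j} → hᶠ i ≡ hᶠ j → i ≡ j
  hᶠ-injective eq = FinP.toℕ-injective (h-inj (FinP.toℕ<n _) (FinP.toℕ<n _)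
    (FinP.fromℕ<-injective _ _ (h<n (FinP.toℕ<n _)) (h<n (FinP.toℕ<n _)) eq))
  onto : ∀ y → ∃ λ x → hᶠ x ≡ y
  onto = injective⇒surjective hᶠ hᶠ-injective
  π : Permutation′ n
  π = permutation hᶠ (proj₁ ∘ onto) (proj₂ ∘ onto) (λ x → hᶠ-injective (proj₂ (onto (hᶠ x))))

-- Signs

ε : ℕ → ℤ
ε zero    = 1ℤ
ε (suc n) = ℤ.- ε n

ε-+ : ∀ m n → ε (m + n) ≡ ε m ℤ.* ε n
ε-+ zero    n = sym (ℤP.*-identityˡ (ε n))
ε-+ (suc m) n = trans (cong ℤ.-_ (ε-+ m n)) (ℤP.neg-distribˡ-* (ε m) (ε n))

ε-*2 : ∀ n → ε (n * 2) ≡ 1ℤ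
ε-*2 zero    = refl
ε-*2 (suc n) = trans (ℤP.neg-involutive (ε (n * 2))) (ε-*2 n)

ε-+*2 : ∀ m k → ε (m + k * 2) ≡ ε m
ε-+*2 m k = trans (ε-+ m (k * 2)) (trans (cong (ε m ℤ.*_) (ε-*2 k)) (ℤP.*-identityʳ (ε m)))

ε-%2 : ∀ n → ε n ≡ ε (n % 2)
ε-%2 n = trans (cong ε (ℕD.m≡m%n+[m/n]*n n 2)) (ε-+*2 (n % 2) (n / 2))

ε-square : ∀ n → ε n ℤ.* ε n ≡ 1ℤ
ε-square n = trans (sym (ε-+ n n)) (trans (cong ε (double n)) (ε-*2 n))
  where
  double : ∀ n → n + n ≡ n * 2
  double = ℕ-Solver.solve-∀

odd⇒ε[pred]≡1 : ∀ n .{{_ : NonZero n}} → n % 2 ≡ 1 → ε (pred n) ≡ 1ℤ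
odd⇒ε[pred]≡1 (suc n) odd = ℤP.neg-injective (trans (ε-%2 (suc n)) (cong ε odd))

odd⇒ε[q*a]≡ε[q] : ∀ q a → a % 2 ≡ 1 → ε (q * a) ≡ ε q
odd⇒ε[q*a]≡ε[q] q a odd = trans (cong ε q*a≡) (ε-+*2 q (q * (a / 2)))
  where
  q*a≡ : q * a ≡ q + q * (a / 2) * 2
  q*a≡ = begin
    q * a                    ≡⟨ cong (q *_) (ℕD.m≡m%n+[m/n]*n a 2) ⟩
    q * (a % 2 + a / 2 * 2)  ≡⟨ cong (λ r → q * (r + a / 2 * 2)) odd ⟩
    q * (1 + a / 2 * 2)      ≡⟨ expand q (a / 2) ⟩
    q + q * (a / 2) * 2      ∎
    where
    expand : ∀ q k → q * (1 + k * 2) ≡ q + q * k * 2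
    expand = ℕ-Solver.solve-∀

odd⇒ε[i/a]≡ε[i]*ε[i%a] : ∀ i a .{{_ : NonZero a}} → a % 2 ≡ 1 → ε (i / a) ≡ ε i ℤ.* ε (i % a)
odd⇒ε[i/a]≡ε[i]*ε[i%a] i a odd = begin
  ε (i / a)                                ≡⟨ sym (ℤP.*-identityʳ _) ⟩
  ε (i / a) ℤ.* 1ℤ                         ≡⟨ cong (ε (i / a) ℤ.*_) (sym (ε-square (i % a))) ⟩
  ε (i / a) ℤ.* (ε (i % a) ℤ.* ε (i % a))  ≡⟨ reorder (ε (i / a)) (ε (i % a)) ⟩
  ε (i % a) ℤ.* ε (i / a) ℤ.* ε (i % a)    ≡⟨ cong (ℤ._* ε (i % a)) (sym εi) ⟩
  ε i ℤ.* ε (i % a)                        ∎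
  where
  reorder : ∀ x y → x ℤ.* (y ℤ.* y) ≡ y ℤ.* x ℤ.* y
  reorder = solve-∀
  εi : ε i ≡ ε (i % a) ℤ.* ε (i / a)
  εi = trans (cong ε (ℕD.m≡m%n+[m/n]*n i a))
             (trans (ε-+ (i % a) (i / a * a)) (cong (ε (i % a) ℤ.*_) (odd⇒ε[q*a]≡ε[q] (i / a) a odd)))

Σε≡n%2 : ∀ n → Σ n ε ≡ + (n % 2)
Σε≡n%2 zero          = refl
Σε≡n%2 (suc zero)    = refl
Σε≡n%2 (suc (suc n)) = begin
  Σ n ε ℤ.+ ε n ℤ.+ ℤ.- ε n  ≡⟨ cancel (Σ n ε) (ε n) ⟩
  Σ n ε                       ≡⟨ Σε≡n%2 n ⟩
  + (n % 2)                   ≡⟨ cong +_ (sym (trans (cong (_% 2) (ℕP.+-comm 2 n)) (ℕD.[m+n]%n≡m%n n 2))) ⟩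
  + (suc (suc n) % 2)         ∎
  where
  cancel : ∀ x y → x ℤ.+ y ℤ.+ ℤ.- y ≡ x
  cancel = solve-∀

-- Floor division

/-suc : ∀ m d .{{_ : NonZero d}} →
        d ∣ suc m × suc m / d ≡ suc (m / d) ⊎ ¬ d ∣ suc m × suc m / d ≡ m / d
/-suc m d with ℕP.m≤n⇒m<n∨m≡n (ℕD.m%n<n m d)
... | inj₂ 1+r≡d = inj₁ (divides (suc (m / d)) split , trans (cong (_/ d) split) (ℕD.m*n/n≡m (suc (m / d)) d))
  where
  split : suc m ≡ suc (m / d) * d
  split = begin
    suc m                    ≡⟨ cong suc (ℕD.m≡m%n+[m/n]*n m d) ⟩
    suc (m % d) + m / d * d  ≡⟨ cong (_+ m / d * d) 1+r≡d ⟩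
    d + m / d * d            ∎
... | inj₁ 1+r<d = inj₂ (d∤ , quotient)
  where
  split : suc m ≡ suc (m % d) + m / d * d
  split = cong suc (ℕD.m≡m%n+[m/n]*n m d)
  quotient : suc m / d ≡ m / d
  quotient = begin
    suc m / d                        ≡⟨ cong (_/ d) split ⟩
    (suc (m % d) + m / d * d) / d    ≡⟨ ℕD.+-distrib-/-∣ʳ (suc (m % d)) (ℕDiv.n∣m*n (m / d)) ⟩
    suc (m % d) / d + m / d * d / d  ≡⟨ cong₂ _+_ (ℕD.m<n⇒m/n≡0 1+r<d) (ℕD.m*n/n≡m (m / d) d) ⟩
    m / d                            ∎
  d∤ : ¬ d ∣ suc m
  d∤ d∣ = ℕP.0≢1+n (begin
    0                              ≡⟨ sym (ℕDiv.n∣m⇒m%n≡0 (suc m) d d∣) ⟩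
    suc m % d                      ≡⟨ cong (_% d) split ⟩
    (suc (m % d) + m / d * d) % d  ≡⟨ ℕD.[m+kn]%n≡m%n (suc (m % d)) (m / d) d ⟩
    suc (m % d) % d                ≡⟨ ℕD.m<n⇒m%n≡m 1+r<d ⟩
    suc (m % d)                    ∎)

pred-/-∤ : ∀ n d .{{_ : NonZero d}} → ¬ d ∣ n → pred n / d ≡ n / d
pred-/-∤ zero    d d∤ = contradiction (d ℕDiv.∣0) d∤
pred-/-∤ (suc n) d d∤ with /-suc n d
... | inj₁ (d∣ , _) = contradiction d∣ d∤
... | inj₂ (_ , q)  = sym q

pred[m*n]/n≡pred[m] : ∀ m n .{{_ : NonZero n}} → pred (m * n) / n ≡ pred m
pred[m*n]/n≡pred[m] zero    n           = ℕD.0/n≡0 n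
pred[m*n]/n≡pred[m] (suc k) n@(suc n-1) = begin
  (n-1 + k * n) / n    ≡⟨ ℕD.+-distrib-/-∣ʳ n-1 (ℕDiv.n∣m*n k) ⟩
  n-1 / n + k * n / n  ≡⟨ cong₂ _+_ (ℕD.m<n⇒m/n≡0 ℕP.≤-refl) (ℕD.m*n/n≡m k n) ⟩
  k                    ∎

/-cancel : ∀ {n d} m k o .{{_ : NonZero d}} .{{_ : NonZero o}} .{{_ : NonZero k}} →
           n ≡ m * k → d ≡ o * k → n / d ≡ m / o
/-cancel m k o n≡ d≡ = trans (ℕD./-congˡ n≡) (trans (ℕD./-congʳ d≡) (ℕD.m*n/o*n≡m/o m k o))
  where instance _ = ℕP.m*n≢0 o k

pos-pred : ∀ n .{{_ : NonZero n}} → + pred n ≡ + n ℤ.- 1ℤ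
pos-pred (suc n) = sym (trans (cong (ℤ._- 1ℤ) (ℤP.pos-+ 1 n)) (cancel (+ n)))
  where
  cancel : ∀ x → 1ℤ ℤ.+ x ℤ.- 1ℤ ≡ x
  cancel = solve-∀

pos-% : ∀ n d .{{_ : NonZero d}} → + (n % d) ≡ + n ℤ.- + d ℤ.* + (n / d)
pos-% n d = begin
  + (n % d)                                              ≡⟨ sym (cancel (+ (n % d)) (+ d ℤ.* + (n / d))) ⟩
  + (n % d) ℤ.+ + d ℤ.* + (n / d) ℤ.- + d ℤ.* + (n / d)  ≡⟨ cong (ℤ._- + d ℤ.* + (n / d)) r+dq≡n ⟩
  + n ℤ.- + d ℤ.* + (n / d)                              ∎
  where
  cancel : ∀ x y → x ℤ.+ y ℤ.- y ≡ x
  cancel = solve-∀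
  r+dq≡n : + (n % d) ℤ.+ + d ℤ.* + (n / d) ≡ + n
  r+dq≡n = begin
    + (n % d) ℤ.+ + d ℤ.* + (n / d)  ≡⟨ cong (ℤ._+_ (+ (n % d))) (sym (ℤP.pos-* d (n / d))) ⟩
    + (n % d) ℤ.+ + (d * (n / d))    ≡⟨ sym (ℤP.pos-+ (n % d) (d * (n / d))) ⟩
    + (n % d + d * (n / d))          ≡⟨ cong (λ t → + (n % d + t)) (ℕP.*-comm d (n / d)) ⟩
    + (n % d + n / d * d)            ≡⟨ cong +_ (sym (ℕD.m≡m%n+[m/n]*n n d)) ⟩
    + n                              ∎

coprime⇒∤* : ∀ {d c x} .{{_ : NonZero x}} → Coprime d c → x < d → ¬ d ∣ c * x
coprime⇒∤* cop x<d d∣cx = ℕDiv.>⇒∤ x<d (coprime-divisor cop d∣cx)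

coprime⇒*∣ : ∀ {a b c t} .{{_ : NonZero c}} → Coprime a b → b * c ∣ t → a * c ∣ t → a * b * c ∣ t
coprime⇒*∣ {a} {b} {c} a⊥b (divides k refl) ac∣kbc with coprime-divisor a⊥b a∣bk
  where
  a∣bk : a ∣ b * k
  a∣bk = subst (a ∣_) (ℕP.*-comm k b) (ℕDiv.*-cancelʳ-∣ c (subst (a * c ∣_) (sym (ℕP.*-assoc k b c)) ac∣kbc))
... | divides l refl = divides l (reassoc l a b c)
  where
  reassoc : ∀ l a b c → l * a * (b * c) ≡ l * (a * b * c)
  reassoc = ℕ-Solver.solve-∀

[x+i*a]%b-injective : ∀ x a b .{{_ : NonZero b}} → Coprime b a →
                      ∀ {i j} → i ≤ j → j < b → (x + i * a) % b ≡ (x + j * a) % b → i ≡ j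
[x+i*a]%b-injective x a b b⊥a {i} {j} i≤j j<b same = begin
  i        ≡⟨ sym (ℕP.+-identityʳ i) ⟩
  i + 0    ≡⟨ cong (_+_ i) (sym k≡0) ⟩
  i + k    ≡⟨ ℕP.m+[n∸m]≡n i≤j ⟩
  j        ∎
  where
  k = j ∸ i
  u = x + i * a
  q₁ = u / b
  q₂ = (u + k * a) / b
  shifted : x + j * a ≡ u + k * a
  shifted = begin
    x + j * a          ≡⟨ cong (λ t → x + t * a) (sym (ℕP.m+[n∸m]≡n i≤j)) ⟩
    x + (i + k) * a    ≡⟨ regroup x i k a ⟩
    x + i * a + k * a  ∎
    where
    regroup : ∀ x i k a → x + (i + k) * a ≡ x + i * a + k * a
    regroup = ℕ-Solver.solve-∀
  k*a≡ : k * a ≡ (q₂ ∸ q₁) * b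
  k*a≡ = begin
    k * a                                        ≡⟨ sym (ℕP.m+n∸m≡n u (k * a)) ⟩
    u + k * a ∸ u                                ≡⟨ cong₂ _∸_ (ℕD.m≡m%n+[m/n]*n (u + k * a) b) (ℕD.m≡m%n+[m/n]*n u b) ⟩
    (u + k * a) % b + q₂ * b ∸ (u % b + q₁ * b)  ≡⟨ cong (λ r → r + q₂ * b ∸ (u % b + q₁ * b))
                                                         (trans (cong (_% b) (sym shifted)) (sym same)) ⟩
    u % b + q₂ * b ∸ (u % b + q₁ * b)            ≡⟨ ℕP.[m+n]∸[m+o]≡n∸o (u % b) (q₂ * b) (q₁ * b) ⟩
    q₂ * b ∸ q₁ * b                              ≡⟨ sym (ℕP.*-distribʳ-∸ b q₂ q₁) ⟩
    (q₂ ∸ q₁) * b                                ∎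
  k≡0 : k ≡ 0
  k≡0 = trans (sym (ℕD.m<n⇒m%n≡m (ℕP.≤-<-trans (ℕP.m∸n≤m j i) j<b)))
              (ℕDiv.n∣m⇒m%n≡0 k b (coprime-divisor b⊥a (divides (q₂ ∸ q₁) (trans (ℕP.*-comm a k) k*a≡))))

-- Chinese remainder sums

Σ-chinese-remainder : ∀ a b .{{_ : NonZero a}} .{{_ : NonZero b}} → Coprime b a → ∀ f g →
                      Σ (b * a) (λ i → f (i % a) ℤ.* g (i % b)) ≡ Σ a f ℤ.* Σ b g
Σ-chinese-remainder a b b⊥a f g = begin
  Σ (b * a) (λ i → f (i % a) ℤ.* g (i % b))
    ≡⟨ Σ-blocks b a _ ⟩
  Σ b (λ q → Σ a (λ x → f ((x + q * a) % a) ℤ.* g ((x + q * a) % b)))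
    ≡⟨ Σ-cong b (λ {q} _ → Σ-cong a (λ {x} x<a → cong (λ r → f r ℤ.* g ((x + q * a) % b))
                                                      (trans (ℕD.[m+kn]%n≡m%n x q a) (ℕD.m<n⇒m%n≡m x<a)))) ⟩
  Σ b (λ q → Σ a (λ x → f x ℤ.* g ((x + q * a) % b)))
    ≡⟨ Σ-comm b a _ ⟩
  Σ a (λ x → Σ b (λ q → f x ℤ.* g ((x + q * a) % b)))
    ≡⟨ Σ-cong a (λ {x} _ → trans (Σ-distribˡ-* b (f x) _)
                                 (cong (f x ℤ.*_) (Σ-permute b _ (λ _ → ℕD.m%n<n _ b) (injective x) g))) ⟩
  Σ a (λ x → f x ℤ.* Σ b g)
    ≡⟨ Σ-distribʳ-* a (Σ b g) f ⟩
  Σ a f ℤ.* Σ b g ∎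
  where
  injective : ∀ x {i j} → i < b → j < b → (x + i * a) % b ≡ (x + j * a) % b → i ≡ j
  injective x {i} {j} i<b j<b same with ℕP.≤-total i j
  ... | inj₁ i≤j = [x+i*a]%b-injective x a b b⊥a i≤j j<b same
  ... | inj₂ j≤i = sym ([x+i*a]%b-injective x a b b⊥a j≤i i<b (sym same))

Σε[i/b+i/a]≡1 : ∀ a b .{{_ : NonZero a}} .{{_ : NonZero b}} → a % 2 ≡ 1 → b % 2 ≡ 1 → Coprime b a →
                Σ (b * a) (λ i → ε (i / b + i / a)) ≡ 1ℤ
Σε[i/b+i/a]≡1 a b a-odd b-odd b⊥a = begin
  Σ (b * a) (λ i → ε (i / b + i / a))        ≡⟨ Σ-cong (b * a) (λ {i} _ → split i) ⟩
  Σ (b * a) (λ i → ε (i % a) ℤ.* ε (i % b))  ≡⟨ Σ-chinese-remainder a b b⊥a ε ε ⟩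
  Σ a ε ℤ.* Σ b ε                            ≡⟨ cong₂ ℤ._*_ (trans (Σε≡n%2 a) (cong +_ a-odd)) (trans (Σε≡n%2 b) (cong +_ b-odd)) ⟩
  1ℤ                                         ∎
  where
  split : ∀ i → ε (i / b + i / a) ≡ ε (i % a) ℤ.* ε (i % b)
  split i = begin
    ε (i / b + i / a)                          ≡⟨ ε-+ (i / b) (i / a) ⟩
    ε (i / b) ℤ.* ε (i / a)                    ≡⟨ cong₂ ℤ._*_ (odd⇒ε[i/a]≡ε[i]*ε[i%a] i b b-odd) (odd⇒ε[i/a]≡ε[i]*ε[i%a] i a a-odd) ⟩
    ε i ℤ.* ε (i % b) ℤ.* (ε i ℤ.* ε (i % a))  ≡⟨ regroup (ε i) (ε (i % a)) (ε (i % b)) ⟩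
    ε i ℤ.* ε i ℤ.* (ε (i % a) ℤ.* ε (i % b))  ≡⟨ cong (ℤ._* (ε (i % a) ℤ.* ε (i % b))) (ε-square i) ⟩
    1ℤ ℤ.* (ε (i % a) ℤ.* ε (i % b))           ≡⟨ ℤP.*-identityˡ _ ⟩
    ε (i % a) ℤ.* ε (i % b)                    ∎
    where
    regroup : ∀ e x y → e ℤ.* y ℤ.* (e ℤ.* x) ≡ e ℤ.* e ℤ.* (x ℤ.* y)
    regroup = solve-∀

-- Summation by parts

Δ : (ℕ → ℤ) → ℕ → ℤ
Δ f s = f (suc s) ℤ.- f s

summation-by-parts : ∀ (f w : ℕ → ℤ) m →
  Σ m (λ s → f (suc s) ℤ.* Δ w s) ≡ f m ℤ.* w m ℤ.- f 0 ℤ.* w 0 ℤ.- Σ m (λ s → Δ f s ℤ.* w s)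
summation-by-parts f w zero    = empty (f 0 ℤ.* w 0)
  where
  empty : ∀ x → 0ℤ ≡ x ℤ.- x ℤ.- 0ℤ
  empty = solve-∀
summation-by-parts f w (suc m) = begin
  Σ m (λ s → f (suc s) ℤ.* Δ w s) ℤ.+ f (suc m) ℤ.* Δ w m
    ≡⟨ cong (ℤ._+ f (suc m) ℤ.* Δ w m) (summation-by-parts f w m) ⟩
  f m ℤ.* w m ℤ.- f 0 ℤ.* w 0 ℤ.- Σ m (λ s → Δ f s ℤ.* w s) ℤ.+ f (suc m) ℤ.* Δ w m
    ≡⟨ step (f m) (w m) (f (suc m)) (w (suc m)) (f 0 ℤ.* w 0) (Σ m (λ s → Δ f s ℤ.* w s)) ⟩
  f (suc m) ℤ.* w (suc m) ℤ.- f 0 ℤ.* w 0 ℤ.- Σ (suc m) (λ s → Δ f s ℤ.* w s) ∎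
  where
  step : ∀ x y x′ y′ z S → x ℤ.* y ℤ.- z ℤ.- S ℤ.+ x′ ℤ.* (y′ ℤ.- y)
                         ≡ x′ ℤ.* y′ ℤ.- z ℤ.- (S ℤ.+ (x′ ℤ.- x) ℤ.* y)
  step = solve-∀

⌊_/_⌋ℤ : ℕ → (d : ℕ) .{{_ : NonZero d}} → ℤ
⌊ s / d ⌋ℤ = + (s / d)

Δ⌊/⌋≡1 : ∀ {s} d .{{_ : NonZero d}} → suc s / d ≡ suc (s / d) → Δ ⌊_/ d ⌋ℤ s ≡ 1ℤ
Δ⌊/⌋≡1 {s} d q = begin
  + (suc s / d) ℤ.- + (s / d)     ≡⟨ cong (λ k → + k ℤ.- + (s / d)) q ⟩
  + suc (s / d) ℤ.- + (s / d)     ≡⟨ cong (ℤ._- + (s / d)) (ℤP.pos-+ 1 (s / d)) ⟩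
  1ℤ ℤ.+ + (s / d) ℤ.- + (s / d)  ≡⟨ cancel 1ℤ (+ (s / d)) ⟩
  1ℤ                              ∎
  where
  cancel : ∀ x y → x ℤ.+ y ℤ.- y ≡ x
  cancel = solve-∀

Δ⌊/⌋≡0 : ∀ {s} d .{{_ : NonZero d}} → suc s / d ≡ s / d → Δ ⌊_/ d ⌋ℤ s ≡ 0ℤ
Δ⌊/⌋≡0 d q = ℤP.i≡j⇒i-j≡0 (cong +_ q)

Σ-Δ⌊/⌋ : ∀ d .{{_ : NonZero d}} (h : ℕ → ℤ) m →
         Σ m (λ s → Δ ⌊_/ d ⌋ℤ s ℤ.* h (suc s)) ≡ Σ (m / d) (λ j → h (suc j * d))
Σ-Δ⌊/⌋ d h zero    = cong (λ k → Σ k (λ j → h (suc j * d))) (sym (ℕD.0/n≡0 d))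
Σ-Δ⌊/⌋ d h (suc m) with /-suc m d
... | inj₁ (d∣ , q) = begin
  Σ m (λ s → Δ ⌊_/ d ⌋ℤ s ℤ.* h (suc s)) ℤ.+ Δ ⌊_/ d ⌋ℤ m ℤ.* h (suc m)
    ≡⟨ cong₂ ℤ._+_ (Σ-Δ⌊/⌋ d h m) (trans (cong (ℤ._* h (suc m)) (Δ⌊/⌋≡1 d q)) (ℤP.*-identityˡ (h (suc m)))) ⟩
  Σ (m / d) (λ j → h (suc j * d)) ℤ.+ h (suc m)
    ≡⟨ cong (λ t → Σ (m / d) (λ j → h (suc j * d)) ℤ.+ h t) (trans (sym (ℕD.m/n*n≡m d∣)) (cong (_* d) q)) ⟩
  Σ (suc (m / d)) (λ j → h (suc j * d))
    ≡⟨ cong (λ k → Σ k (λ j → h (suc j * d))) (sym q) ⟩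
  Σ (suc m / d) (λ j → h (suc j * d)) ∎
... | inj₂ (_ , q) = begin
  Σ m (λ s → Δ ⌊_/ d ⌋ℤ s ℤ.* h (suc s)) ℤ.+ Δ ⌊_/ d ⌋ℤ m ℤ.* h (suc m)
    ≡⟨ cong₂ ℤ._+_ (Σ-Δ⌊/⌋ d h m) (trans (cong (ℤ._* h (suc m)) (Δ⌊/⌋≡0 d q)) (ℤP.*-zeroˡ (h (suc m)))) ⟩
  Σ (m / d) (λ j → h (suc j * d)) ℤ.+ 0ℤ
    ≡⟨ ℤP.+-identityʳ _ ⟩
  Σ (m / d) (λ j → h (suc j * d))
    ≡⟨ cong (λ k → Σ k (λ j → h (suc j * d))) (sym q) ⟩
  Σ (suc m / d) (λ j → h (suc j * d)) ∎

module StepFunction (P Q : ℕ) .{{_ : NonZero P}} .{{_ : NonZero Q}} where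

  φ : ℕ → ℤ
  φ s = ε (s / P + s / Q)

  jumpSum : (d : ℕ) .{{_ : NonZero d}} → (ℕ → ℤ) → ℕ → ℤ
  jumpSum d w n = Σ n (λ j → φ (suc j * d) ℤ.* w (pred (suc j * d)))

  private
    sign-flips : ∀ {x x′ δ} → x′ ≡ ℤ.- x → δ ≡ 1ℤ → x′ ℤ.- x ≡ + 2 ℤ.* δ ℤ.* x′
    sign-flips {x} refl refl = twice x
      where
      twice : ∀ x → ℤ.- x ℤ.- x ≡ + 2 ℤ.* 1ℤ ℤ.* ℤ.- x
      twice = solve-∀

    sign-stays : ∀ {x x′ δ} → x′ ≡ x → δ ≡ 0ℤ → x′ ℤ.- x ≡ + 2 ℤ.* δ ℤ.* x′
    sign-stays {x} refl refl = trans (ℤP.+-inverseʳ x) (sym (ℤP.*-zeroˡ x))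

  Δφ : ∀ s → ¬ (P ∣ suc s × Q ∣ suc s) →
       Δ φ s ≡ + 2 ℤ.* (Δ ⌊_/ P ⌋ℤ s ℤ.+ Δ ⌊_/ Q ⌋ℤ s) ℤ.* φ (suc s)
  Δφ s ¬both with /-suc s P | /-suc s Q
  ... | inj₁ (P∣ , _) | inj₁ (Q∣ , _) = contradiction (P∣ , Q∣) ¬both
  ... | inj₁ (_ , qP) | inj₂ (_ , qQ) =
    sign-flips (cong ε (cong₂ _+_ qP qQ)) (cong₂ ℤ._+_ (Δ⌊/⌋≡1 P qP) (Δ⌊/⌋≡0 Q qQ))
  ... | inj₂ (_ , qP) | inj₁ (_ , qQ) =
    sign-flips (cong ε (trans (cong₂ _+_ qP qQ) (ℕP.+-suc (s / P) (s / Q))))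
               (cong₂ ℤ._+_ (Δ⌊/⌋≡0 P qP) (Δ⌊/⌋≡1 Q qQ))
  ... | inj₂ (_ , qP) | inj₂ (_ , qQ) =
    sign-stays (cong ε (cong₂ _+_ qP qQ)) (cong₂ ℤ._+_ (Δ⌊/⌋≡0 P qP) (Δ⌊/⌋≡0 Q qQ))

  abel-summation : ∀ (w : ℕ → ℤ) m → (∀ {s} → s < m → ¬ (P ∣ suc s × Q ∣ suc s)) →
    Σ m (λ s → φ (suc s) ℤ.* Δ w s)
      ≡ φ m ℤ.* w m ℤ.- φ 0 ℤ.* w 0 ℤ.- + 2 ℤ.* (jumpSum P w (m / P) ℤ.+ jumpSum Q w (m / Q))
  abel-summation w m no-common-multiple = begin
    Σ m (λ s → φ (suc s) ℤ.* Δ w s)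
      ≡⟨ summation-by-parts φ w m ⟩
    φ m ℤ.* w m ℤ.- φ 0 ℤ.* w 0 ℤ.- Σ m (λ s → Δ φ s ℤ.* w s)
      ≡⟨ cong (ℤ._-_ (φ m ℤ.* w m ℤ.- φ 0 ℤ.* w 0)) jumps ⟩
    φ m ℤ.* w m ℤ.- φ 0 ℤ.* w 0 ℤ.- + 2 ℤ.* (jumpSum P w (m / P) ℤ.+ jumpSum Q w (m / Q)) ∎
    where
    h : ℕ → ℤ
    h t = φ t ℤ.* w (pred t)
    split : ∀ {s} → s < m → Δ φ s ℤ.* w s ≡ + 2 ℤ.* (Δ ⌊_/ P ⌋ℤ s ℤ.* h (suc s) ℤ.+ Δ ⌊_/ Q ⌋ℤ s ℤ.* h (suc s))
    split {s} s<m = trans (cong (ℤ._* w s) (Δφ s (no-common-multiple s<m)))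
                          (expand (Δ ⌊_/ P ⌋ℤ s) (Δ ⌊_/ Q ⌋ℤ s) (φ (suc s)) (w s))
      where
      expand : ∀ δ δ′ x y → + 2 ℤ.* (δ ℤ.+ δ′) ℤ.* x ℤ.* y ≡ + 2 ℤ.* (δ ℤ.* (x ℤ.* y) ℤ.+ δ′ ℤ.* (x ℤ.* y))
      expand = solve-∀
    jumps : Σ m (λ s → Δ φ s ℤ.* w s) ≡ + 2 ℤ.* (jumpSum P w (m / P) ℤ.+ jumpSum Q w (m / Q))
    jumps = begin
      Σ m (λ s → Δ φ s ℤ.* w s)
        ≡⟨ Σ-cong m split ⟩
      Σ m (λ s → + 2 ℤ.* (Δ ⌊_/ P ⌋ℤ s ℤ.* h (suc s) ℤ.+ Δ ⌊_/ Q ⌋ℤ s ℤ.* h (suc s)))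
        ≡⟨ Σ-distribˡ-* m (+ 2) _ ⟩
      + 2 ℤ.* Σ m (λ s → Δ ⌊_/ P ⌋ℤ s ℤ.* h (suc s) ℤ.+ Δ ⌊_/ Q ⌋ℤ s ℤ.* h (suc s))
        ≡⟨ cong (+ 2 ℤ.*_) (Σ-distrib-+ m _ _) ⟩
      + 2 ℤ.* (Σ m (λ s → Δ ⌊_/ P ⌋ℤ s ℤ.* h (suc s)) ℤ.+ Σ m (λ s → Δ ⌊_/ Q ⌋ℤ s ℤ.* h (suc s)))
        ≡⟨ cong (+ 2 ℤ.*_) (cong₂ ℤ._+_ (Σ-Δ⌊/⌋ P h m) (Σ-Δ⌊/⌋ Q h m)) ⟩
      + 2 ℤ.* (jumpSum P w (m / P) ℤ.+ jumpSum Q w (m / Q)) ∎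

-- The integer identity

-- sawℤ d n = 2d·((n/d))
sawℤ : (d : ℕ) .{{_ : NonZero d}} → ℕ → ℤ
sawℤ d n with n % d
... | zero  = 0ℤ
... | suc r = + 2 ℤ.* + suc r ℤ.- + d

sawℤ-∣ : ∀ d .{{_ : NonZero d}} n → d ∣ n → sawℤ d n ≡ 0ℤ
sawℤ-∣ d n d∣n with n % d in eq
... | zero  = refl
... | suc r = contradiction (trans (sym eq) (ℕDiv.n∣m⇒m%n≡0 n d d∣n)) ℕP.1+n≢0

sawℤ-∤ : ∀ d .{{_ : NonZero d}} n → ¬ d ∣ n → sawℤ d n ≡ + 2 ℤ.* + (n % d) ℤ.- + d
sawℤ-∤ d n d∤n with n % d in eq
... | zero  = contradiction (ℕDiv.m%n≡0⇒n∣m n d eq) d∤n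
... | suc r = refl

-- s₅-numerator e c d = 2d·s₅(e, c, d)
s₅-numerator : (e c d : ℕ) .{{_ : NonZero d}} → ℤ
s₅-numerator e c d = Σ d (λ r → ε (r + e * r / d) ℤ.* sawℤ d (c * r))

weight : (c D : ℕ) .{{_ : NonZero c}} .{{_ : NonZero D}} → ℕ → ℤ
weight c D s = + 2 ℤ.* + c ℤ.* ⌊ s / c ⌋ℤ ℤ.- + 2 ℤ.* + D ℤ.* ⌊ s / D ⌋ℤ ℤ.+ (+ 2 ℤ.* + c ℤ.- + D)

weight-at-jump : ∀ d e c {D} .{{_ : NonZero d}} .{{_ : NonZero e}} .{{_ : NonZero c}} .{{_ : NonZero D}} →
                 D ≡ e * d → Coprime d c → ∀ {j} → suc j < d →
                 weight c D (pred (suc j * (e * c))) ≡ + e ℤ.* sawℤ d (c * suc j)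
weight-at-jump d e c {D} D≡ d⊥c {j} 1+j<d = begin
  weight c D t
    ≡⟨ cong₂ (λ u v → + 2 ℤ.* + c ℤ.* + u ℤ.- + 2 ℤ.* + D ℤ.* + v ℤ.+ (+ 2 ℤ.* + c ℤ.- + D)) t/c t/D ⟩
  + 2 ℤ.* + c ℤ.* + pred (suc j * e) ℤ.- + 2 ℤ.* + D ℤ.* + q ℤ.+ (+ 2 ℤ.* + c ℤ.- + D)
    ≡⟨ cong₂ (λ u v → + 2 ℤ.* + c ℤ.* u ℤ.- + 2 ℤ.* v ℤ.* + q ℤ.+ (+ 2 ℤ.* + c ℤ.- v))
             (trans (pos-pred (suc j * e) {{ℕP.m*n≢0 (suc j) e}}) (cong (ℤ._- 1ℤ) (ℤP.pos-* (suc j) e)))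
             (trans (cong +_ D≡) (ℤP.pos-* e d)) ⟩
  + 2 ℤ.* + c ℤ.* (+ suc j ℤ.* + e ℤ.- 1ℤ) ℤ.- + 2 ℤ.* (+ e ℤ.* + d) ℤ.* + q ℤ.+ (+ 2 ℤ.* + c ℤ.- + e ℤ.* + d)
    ≡⟨ algebra (+ c) (+ suc j) (+ e) (+ d) (+ q) ⟩
  + e ℤ.* (+ 2 ℤ.* (+ c ℤ.* + suc j ℤ.- + d ℤ.* + q) ℤ.- + d)
    ≡⟨ cong (λ r → + e ℤ.* (+ 2 ℤ.* r ℤ.- + d)) (sym remainder) ⟩
  + e ℤ.* (+ 2 ℤ.* + (c * suc j % d) ℤ.- + d)
    ≡⟨ cong (ℤ._*_ (+ e)) (sym (sawℤ-∤ d (c * suc j) d∤)) ⟩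
  + e ℤ.* sawℤ d (c * suc j) ∎
  where
  instance
    e*d≢0 : NonZero (e * d)
    e*d≢0 = ℕP.m*n≢0 e d
  t = pred (suc j * (e * c))
  q = c * suc j / d
  d∤ : ¬ d ∣ c * suc j
  d∤ = coprime⇒∤* d⊥c 1+j<d
  t/c : t / c ≡ pred (suc j * e)
  t/c = trans (ℕD./-congˡ (cong pred (sym (ℕP.*-assoc (suc j) e c)))) (pred[m*n]/n≡pred[m] (suc j * e) c)
  t/D : t / D ≡ q
  t/D = begin
    t / D                 ≡⟨ ℕD./-congʳ D≡ ⟩
    t / (e * d)           ≡⟨ sym (ℕD.m/n/o≡m/[n*o] t e d) ⟩
    t / e / d             ≡⟨ cong (_/ d) (trans (ℕD./-congˡ (cong pred (reorder (suc j) e c)))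
                                                (pred[m*n]/n≡pred[m] (c * suc j) e)) ⟩
    pred (c * suc j) / d  ≡⟨ pred-/-∤ (c * suc j) d d∤ ⟩
    q                     ∎
    where
    reorder : ∀ x e c → x * (e * c) ≡ c * x * e
    reorder = ℕ-Solver.solve-∀
  remainder : + (c * suc j % d) ≡ + c ℤ.* + suc j ℤ.- + d ℤ.* + q
  remainder = trans (pos-% (c * suc j) d) (cong (λ r → r ℤ.- + d ℤ.* + q) (ℤP.pos-* c (suc j)))
  algebra : ∀ c x e d q → + 2 ℤ.* c ℤ.* (x ℤ.* e ℤ.- 1ℤ) ℤ.- + 2 ℤ.* (e ℤ.* d) ℤ.* q ℤ.+ (+ 2 ℤ.* c ℤ.- e ℤ.* d)
                          ≡ e ℤ.* (+ 2 ℤ.* (c ℤ.* x ℤ.- d ℤ.* q) ℤ.- d)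
  algebra = solve-∀

module JumpSide (d e c : ℕ) .{{_ : NonZero d}} .{{_ : NonZero e}} .{{_ : NonZero c}} (d⊥c : Coprime d c) where
  instance
    e*c≢0 : NonZero (e * c)
    e*c≢0 = ℕP.m*n≢0 e c
    d*c≢0 : NonZero (d * c)
    d*c≢0 = ℕP.m*n≢0 d c

  open StepFunction (e * c) (d * c)

  φ-at-jump : ∀ x → φ (x * (e * c)) ≡ ε (x + e * x / d)
  φ-at-jump x = cong ε (cong₂ _+_ (ℕD.m*n/n≡m x (e * c)) (/-cancel (e * x) c d (reorder x e c) refl))
    where
    reorder : ∀ x e c → x * (e * c) ≡ e * x * c
    reorder = ℕ-Solver.solve-∀

  s₅-numerator-head : s₅-numerator e c d ≡ Σ (pred d) (λ j → ε (suc j + e * suc j / d) ℤ.* sawℤ d (c * suc j))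
  s₅-numerator-head = begin
    Σ d f                         ≡⟨ cong (λ k → Σ k f) (sym (ℕP.suc-pred d)) ⟩
    Σ (suc (pred d)) f            ≡⟨ Σ-head (pred d) f ⟩
    f 0 ℤ.+ Σ (pred d) (f ∘ suc)  ≡⟨ cong (ℤ._+ Σ (pred d) (f ∘ suc)) f0≡0 ⟩
    0ℤ ℤ.+ Σ (pred d) (f ∘ suc)   ≡⟨ ℤP.+-identityˡ _ ⟩
    Σ (pred d) (f ∘ suc)          ∎
    where
    f : ℕ → ℤ
    f r = ε (r + e * r / d) ℤ.* sawℤ d (c * r)
    f0≡0 : f 0 ≡ 0ℤ
    f0≡0 = trans (cong (ε (e * 0 / d) ℤ.*_) (sawℤ-∣ d (c * 0) (subst (d ∣_) (sym (ℕP.*-zeroʳ c)) (d ℕDiv.∣0))))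
                 (ℤP.*-zeroʳ (ε (e * 0 / d)))

  jumpSum≡s₅-numerator : ∀ {D} .{{_ : NonZero D}} → D ≡ e * d →
                         jumpSum (e * c) (weight c D) (pred d) ≡ + e ℤ.* s₅-numerator e c d
  jumpSum≡s₅-numerator {D} D≡ = begin
    jumpSum (e * c) (weight c D) (pred d)
      ≡⟨ Σ-cong (pred d) (λ {j} j<d-1 → cong₂ ℤ._*_ (φ-at-jump (suc j))
           (weight-at-jump d e c D≡ d⊥c (ℕP.<-≤-trans (ℕ.s≤s j<d-1) (ℕP.≤-reflexive (ℕP.suc-pred d))))) ⟩
    Σ (pred d) (λ j → ε (suc j + e * suc j / d) ℤ.* (+ e ℤ.* sawℤ d (c * suc j)))
      ≡⟨ Σ-cong (pred d) (λ {j} _ → swap (ε (suc j + e * suc j / d)) (+ e) (sawℤ d (c * suc j))) ⟩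
    Σ (pred d) (λ j → + e ℤ.* (ε (suc j + e * suc j / d) ℤ.* sawℤ d (c * suc j)))
      ≡⟨ Σ-distribˡ-* (pred d) (+ e) _ ⟩
    + e ℤ.* Σ (pred d) (λ j → ε (suc j + e * suc j / d) ℤ.* sawℤ d (c * suc j))
      ≡⟨ cong (ℤ._*_ (+ e)) (sym s₅-numerator-head) ⟩
    + e ℤ.* s₅-numerator e c d ∎
    where
    swap : ∀ x y z → x ℤ.* (y ℤ.* z) ≡ y ℤ.* (x ℤ.* z)
    swap = solve-∀

module Reciprocity (a b c : ℕ) .{{_ : NonZero a}} .{{_ : NonZero b}} .{{_ : NonZero c}}
                   (a-odd : a % 2 ≡ 1) (b-odd : b % 2 ≡ 1)
                   (a⊥b : Coprime a b) (b⊥c : Coprime b c) (a⊥c : Coprime a c) where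
  instance
    a*b≢0 : NonZero (a * b)
    a*b≢0 = ℕP.m*n≢0 a b
    b*c≢0 : NonZero (b * c)
    b*c≢0 = ℕP.m*n≢0 b c
    a*c≢0 : NonZero (a * c)
    a*c≢0 = ℕP.m*n≢0 a c
    a*b*c≢0 : NonZero (a * b * c)
    a*b*c≢0 = ℕP.m*n≢0 (a * b) c

  open StepFunction (b * c) (a * c)

  T : ℤ
  T = Σ (pred c) (λ r → ε (a * suc r / c + b * suc r / c))

  -- The summation stops just below abc, the first common multiple of bc and ac.
  m : ℕ
  m = pred (a * b * c)

  w : ℕ → ℤ
  w = weight c (a * b)

  m/y≡pred[x] : ∀ x y .{{_ : NonZero y}} → a * b * c ≡ x * y → m / y ≡ pred x
  m/y≡pred[x] x y abc≡xy = trans (ℕD./-congˡ {o = y} (cong pred abc≡xy)) (pred[m*n]/n≡pred[m] x y)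

  no-common-multiple : ∀ {s} → s < m → ¬ (b * c ∣ suc s × a * c ∣ suc s)
  no-common-multiple {s} s<m (bc∣ , ac∣) = ℕDiv.>⇒∤ 1+s<abc (coprime⇒*∣ a⊥b bc∣ ac∣)
    where
    1+s<abc : suc s < a * b * c
    1+s<abc = ℕP.<-≤-trans (ℕ.s≤s s<m) (ℕP.≤-reflexive (ℕP.suc-pred (a * b * c)))

  samples-c : Σ (m / c) (λ j → φ (suc j * c)) ≡ 0ℤ
  samples-c = begin
    Σ (m / c) (λ j → φ (suc j * c))            ≡⟨ cong (λ k → Σ k (λ j → φ (suc j * c))) (m/y≡pred[x] (a * b) c refl) ⟩
    Σ (pred (a * b)) (λ j → φ (suc j * c))     ≡⟨ Σ-cong (pred (a * b)) (λ {j} _ → φ-at-c-multiple (suc j)) ⟩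
    Σ (pred (a * b)) (ψ ∘ suc)                 ≡⟨ sym (cancel (Σ (pred (a * b)) (ψ ∘ suc))) ⟩
    1ℤ ℤ.+ Σ (pred (a * b)) (ψ ∘ suc) ℤ.- 1ℤ   ≡⟨ cong (λ x → x ℤ.+ Σ (pred (a * b)) (ψ ∘ suc) ℤ.- 1ℤ) (sym ψ0≡1) ⟩
    ψ 0 ℤ.+ Σ (pred (a * b)) (ψ ∘ suc) ℤ.- 1ℤ  ≡⟨ cong (ℤ._- 1ℤ) (sym (Σ-head (pred (a * b)) ψ)) ⟩
    Σ (suc (pred (a * b))) ψ ℤ.- 1ℤ            ≡⟨ cong (λ k → Σ k ψ ℤ.- 1ℤ) (trans (ℕP.suc-pred (a * b)) (ℕP.*-comm a b)) ⟩
    Σ (b * a) ψ ℤ.- 1ℤ                         ≡⟨ cong (ℤ._- 1ℤ) (Σε[i/b+i/a]≡1 a b a-odd b-odd (Coprimality.sym a⊥b)) ⟩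
    0ℤ                                         ∎
    where
    ψ : ℕ → ℤ
    ψ x = ε (x / b + x / a)
    φ-at-c-multiple : ∀ x → φ (x * c) ≡ ψ x
    φ-at-c-multiple x = cong ε (cong₂ _+_ (/-cancel x c b refl refl) (/-cancel x c a refl refl))
    ψ0≡1 : ψ 0 ≡ 1ℤ
    ψ0≡1 = cong ε (cong₂ _+_ (ℕD.0/n≡0 b) (ℕD.0/n≡0 a))
    cancel : ∀ x → 1ℤ ℤ.+ x ℤ.- 1ℤ ≡ x
    cancel = solve-∀

  samples-ab : Σ (m / (a * b)) (λ j → φ (suc j * (a * b))) ≡ T
  samples-ab = begin
    Σ (m / (a * b)) (λ j → φ (suc j * (a * b)))
      ≡⟨ cong (λ k → Σ k (λ j → φ (suc j * (a * b)))) (m/y≡pred[x] c (a * b) (ℕP.*-comm (a * b) c)) ⟩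
    Σ (pred c) (λ j → φ (suc j * (a * b)))
      ≡⟨ Σ-cong (pred c) (λ {j} _ → cong ε (cong₂ _+_ (/-cancel (a * suc j) b c (reorder a b (suc j)) (ℕP.*-comm b c))
                                                       (/-cancel (b * suc j) a c (reorder′ a b (suc j)) (ℕP.*-comm a c)))) ⟩
    T ∎
    where
    reorder : ∀ a b x → x * (a * b) ≡ a * x * b
    reorder = ℕ-Solver.solve-∀
    reorder′ : ∀ a b x → x * (a * b) ≡ b * x * a
    reorder′ = ℕ-Solver.solve-∀

  samples : Σ m (λ s → φ (suc s) ℤ.* Δ w s) ≡ ℤ.- (+ 2 ℤ.* + (a * b) ℤ.* T)
  samples = begin
    Σ m (λ s → φ (suc s) ℤ.* Δ w s)
      ≡⟨ Σ-cong m (λ {s} _ → distribute (φ (suc s)) (+ c) (+ (a * b))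
                               ⌊ suc s / c ⌋ℤ ⌊ s / c ⌋ℤ ⌊ suc s / (a * b) ⌋ℤ ⌊ s / (a * b) ⌋ℤ) ⟩
    Σ m (λ s → + 2 ℤ.* + c ℤ.* (Δ ⌊_/ c ⌋ℤ s ℤ.* φ (suc s)) ℤ.- + 2 ℤ.* + (a * b) ℤ.* (Δ ⌊_/ a * b ⌋ℤ s ℤ.* φ (suc s)))
      ≡⟨ Σ-linear m (+ 2 ℤ.* + c) (+ 2 ℤ.* + (a * b)) _ _ ⟩
    + 2 ℤ.* + c ℤ.* Σ m (λ s → Δ ⌊_/ c ⌋ℤ s ℤ.* φ (suc s))
      ℤ.- + 2 ℤ.* + (a * b) ℤ.* Σ m (λ s → Δ ⌊_/ a * b ⌋ℤ s ℤ.* φ (suc s))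
      ≡⟨ cong₂ (λ u v → + 2 ℤ.* + c ℤ.* u ℤ.- + 2 ℤ.* + (a * b) ℤ.* v)
               (trans (Σ-Δ⌊/⌋ c φ m) samples-c) (trans (Σ-Δ⌊/⌋ (a * b) φ m) samples-ab) ⟩
    + 2 ℤ.* + c ℤ.* 0ℤ ℤ.- + 2 ℤ.* + (a * b) ℤ.* T
      ≡⟨ drop (+ 2 ℤ.* + c) (+ 2 ℤ.* + (a * b) ℤ.* T) ⟩
    ℤ.- (+ 2 ℤ.* + (a * b) ℤ.* T) ∎
    where
    distribute : ∀ f C D x′ x y′ y →
      f ℤ.* (+ 2 ℤ.* C ℤ.* x′ ℤ.- + 2 ℤ.* D ℤ.* y′ ℤ.+ (+ 2 ℤ.* C ℤ.- D) ℤ.- (+ 2 ℤ.* C ℤ.* x ℤ.- + 2 ℤ.* D ℤ.* y ℤ.+ (+ 2 ℤ.* C ℤ.- D)))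
        ≡ + 2 ℤ.* C ℤ.* ((x′ ℤ.- x) ℤ.* f) ℤ.- + 2 ℤ.* D ℤ.* ((y′ ℤ.- y) ℤ.* f)
    distribute = solve-∀
    drop : ∀ x y → x ℤ.* 0ℤ ℤ.- y ≡ ℤ.- y
    drop = solve-∀

  boundary : φ m ℤ.* w m ℤ.- φ 0 ℤ.* w 0 ≡ + 2 ℤ.* + (a * b) ℤ.- + 2 ℤ.* + c
  boundary = begin
    φ m ℤ.* w m ℤ.- φ 0 ℤ.* w 0                                 ≡⟨ cong₂ ℤ._-_ (cong₂ ℤ._*_ φm≡1 wm≡ab) (cong₂ ℤ._*_ φ0≡1 w0≡2c-ab) ⟩
    1ℤ ℤ.* + (a * b) ℤ.- 1ℤ ℤ.* (+ 2 ℤ.* + c ℤ.- + (a * b))    ≡⟨ algebra (+ (a * b)) (+ c) ⟩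
    + 2 ℤ.* + (a * b) ℤ.- + 2 ℤ.* + c                           ∎
    where
    φm≡1 : φ m ≡ 1ℤ
    φm≡1 = begin
      ε (m / (b * c) + m / (a * c))  ≡⟨ cong ε (cong₂ _+_ (m/y≡pred[x] a (b * c) (ℕP.*-assoc a b c))
                                                          (m/y≡pred[x] b (a * c) (reorder a b c))) ⟩
      ε (pred a + pred b)            ≡⟨ ε-+ (pred a) (pred b) ⟩
      ε (pred a) ℤ.* ε (pred b)      ≡⟨ cong₂ ℤ._*_ (odd⇒ε[pred]≡1 a a-odd) (odd⇒ε[pred]≡1 b b-odd) ⟩
      1ℤ                             ∎
      where
      reorder : ∀ a b c → a * b * c ≡ b * (a * c)
      reorder = ℕ-Solver.solve-∀
    φ0≡1 : φ 0 ≡ 1ℤ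
    φ0≡1 = cong ε (cong₂ _+_ (ℕD.0/n≡0 (b * c)) (ℕD.0/n≡0 (a * c)))
    wm≡ab : w m ≡ + (a * b)
    wm≡ab = trans (cong₂ (λ u v → + 2 ℤ.* + c ℤ.* u ℤ.- + 2 ℤ.* + (a * b) ℤ.* v ℤ.+ (+ 2 ℤ.* + c ℤ.- + (a * b)))
                         (trans (cong +_ (m/y≡pred[x] (a * b) c refl)) (pos-pred (a * b)))
                         (trans (cong +_ (m/y≡pred[x] c (a * b) (ℕP.*-comm (a * b) c))) (pos-pred c)))
                  (top (+ (a * b)) (+ c))
      where
      top : ∀ A C → + 2 ℤ.* C ℤ.* (A ℤ.- 1ℤ) ℤ.- + 2 ℤ.* A ℤ.* (C ℤ.- 1ℤ) ℤ.+ (+ 2 ℤ.* C ℤ.- A) ≡ A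
      top = solve-∀
    w0≡2c-ab : w 0 ≡ + 2 ℤ.* + c ℤ.- + (a * b)
    w0≡2c-ab = trans (cong₂ (λ u v → + 2 ℤ.* + c ℤ.* + u ℤ.- + 2 ℤ.* + (a * b) ℤ.* + v ℤ.+ (+ 2 ℤ.* + c ℤ.- + (a * b)))
                            (ℕD.0/n≡0 c) (ℕD.0/n≡0 (a * b)))
                     (bottom (+ (a * b)) (+ c))
      where
      bottom : ∀ A C → + 2 ℤ.* C ℤ.* 0ℤ ℤ.- + 2 ℤ.* A ℤ.* 0ℤ ℤ.+ (+ 2 ℤ.* C ℤ.- A) ≡ + 2 ℤ.* C ℤ.- A
      bottom = solve-∀
    algebra : ∀ A C → 1ℤ ℤ.* A ℤ.- 1ℤ ℤ.* (+ 2 ℤ.* C ℤ.- A) ≡ + 2 ℤ.* A ℤ.- + 2 ℤ.* C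
    algebra = solve-∀

  jumps : jumpSum (b * c) w (m / (b * c)) ℤ.+ jumpSum (a * c) w (m / (a * c))
          ≡ + b ℤ.* s₅-numerator b c a ℤ.+ + a ℤ.* s₅-numerator a c b
  jumps = cong₂ ℤ._+_
    (trans (cong (jumpSum (b * c) w) (m/y≡pred[x] a (b * c) (ℕP.*-assoc a b c)))
           (JumpSide.jumpSum≡s₅-numerator a b c a⊥c (ℕP.*-comm a b)))
    (trans (cong (jumpSum (a * c) w) (m/y≡pred[x] b (a * c) (reorder a b c)))
           (trans (Σ-cong (pred b) (λ {j} _ → cong (λ t → ε t ℤ.* w (pred (suc j * (a * c))))
                                                   (ℕP.+-comm (suc j * (a * c) / (b * c)) (suc j * (a * c) / (a * c)))))
                  (JumpSide.jumpSum≡s₅-numerator b a c b⊥c refl)))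
    where
    reorder : ∀ a b c → a * b * c ≡ b * (a * c)
    reorder = ℕ-Solver.solve-∀

  reciprocity : + b ℤ.* s₅-numerator b c a ℤ.+ + a ℤ.* s₅-numerator a c b ≡ + (a * b) ℤ.* (T ℤ.+ 1ℤ) ℤ.- + c
  reciprocity = ℤP.*-cancelˡ-≡ (+ 2) _ _ (begin
    + 2 ℤ.* J
      ≡⟨ isolate (+ 2 ℤ.* + (a * b) ℤ.- + 2 ℤ.* + c) J ⟩
    + 2 ℤ.* + (a * b) ℤ.- + 2 ℤ.* + c ℤ.- (+ 2 ℤ.* + (a * b) ℤ.- + 2 ℤ.* + c ℤ.- + 2 ℤ.* J)
      ≡⟨ cong (ℤ._-_ (+ 2 ℤ.* + (a * b) ℤ.- + 2 ℤ.* + c)) (sym abel) ⟩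
    + 2 ℤ.* + (a * b) ℤ.- + 2 ℤ.* + c ℤ.- (ℤ.- (+ 2 ℤ.* + (a * b) ℤ.* T))
      ≡⟨ algebra (+ (a * b)) (+ c) T ⟩
    + 2 ℤ.* (+ (a * b) ℤ.* (T ℤ.+ 1ℤ) ℤ.- + c) ∎)
    where
    J = + b ℤ.* s₅-numerator b c a ℤ.+ + a ℤ.* s₅-numerator a c b
    abel : ℤ.- (+ 2 ℤ.* + (a * b) ℤ.* T) ≡ + 2 ℤ.* + (a * b) ℤ.- + 2 ℤ.* + c ℤ.- + 2 ℤ.* J
    abel = begin
      ℤ.- (+ 2 ℤ.* + (a * b) ℤ.* T)  ≡⟨ sym samples ⟩
      Σ m (λ s → φ (suc s) ℤ.* Δ w s) ≡⟨ abel-summation w m no-common-multiple ⟩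
      φ m ℤ.* w m ℤ.- φ 0 ℤ.* w 0 ℤ.- + 2 ℤ.* (jumpSum (b * c) w (m / (b * c)) ℤ.+ jumpSum (a * c) w (m / (a * c)))
        ≡⟨ cong₂ (λ u v → u ℤ.- + 2 ℤ.* v) boundary jumps ⟩
      + 2 ℤ.* + (a * b) ℤ.- + 2 ℤ.* + c ℤ.- + 2 ℤ.* J ∎
    isolate : ∀ B J → + 2 ℤ.* J ≡ B ℤ.- (B ℤ.- + 2 ℤ.* J)
    isolate = solve-∀
    algebra : ∀ A C T → + 2 ℤ.* A ℤ.- + 2 ℤ.* C ℤ.- (ℤ.- (+ 2 ℤ.* A ℤ.* T)) ≡ + 2 ℤ.* (A ℤ.* (T ℤ.+ 1ℤ) ℤ.- C)
    algebra = solve-∀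

-- Rationals

fromℚᵘ-+ : ∀ u v → ℚ.fromℚᵘ (u ℚᵘ.+ v) ≡ ℚ.fromℚᵘ u ℚ.+ ℚ.fromℚᵘ v
fromℚᵘ-+ u v = ℚP.toℚᵘ-injective (ℚᵘP.≃-trans (ℚP.toℚᵘ-fromℚᵘ (u ℚᵘ.+ v)) (ℚᵘP.≃-sym
  (ℚᵘP.≃-trans (ℚP.toℚᵘ-homo-+ (ℚ.fromℚᵘ u) (ℚ.fromℚᵘ v)) (ℚᵘP.+-cong (ℚP.toℚᵘ-fromℚᵘ u) (ℚP.toℚᵘ-fromℚᵘ v)))))

fromℚᵘ-* : ∀ u v → ℚ.fromℚᵘ (u ℚᵘ.* v) ≡ ℚ.fromℚᵘ u ℚ.* ℚ.fromℚᵘ v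
fromℚᵘ-* u v = ℚP.toℚᵘ-injective (ℚᵘP.≃-trans (ℚP.toℚᵘ-fromℚᵘ (u ℚᵘ.* v)) (ℚᵘP.≃-sym
  (ℚᵘP.≃-trans (ℚP.toℚᵘ-homo-* (ℚ.fromℚᵘ u) (ℚ.fromℚᵘ v)) (ℚᵘP.*-cong (ℚP.toℚᵘ-fromℚᵘ u) (ℚP.toℚᵘ-fromℚᵘ v)))))

fromℚᵘ-neg : ∀ u → ℚ.fromℚᵘ (ℚᵘ.- u) ≡ ℚ.- ℚ.fromℚᵘ u
fromℚᵘ-neg u = ℚP.toℚᵘ-injective (ℚᵘP.≃-trans (ℚP.toℚᵘ-fromℚᵘ (ℚᵘ.- u)) (ℚᵘP.≃-sym
  (ℚᵘP.≃-trans (ℚP.toℚᵘ-homo‿- (ℚ.fromℚᵘ u)) (ℚᵘP.-‿cong (ℚP.toℚᵘ-fromℚᵘ u)))))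

/-cross : ∀ {x y} d e .{{_ : NonZero d}} .{{_ : NonZero e}} → x ℤ.* + e ≡ y ℤ.* + d → x ℚ./ d ≡ y ℚ./ e
/-cross {x} {y} (suc d) (suc e) eq = ℚP.fromℚᵘ-cong {mkℚᵘ x d} {mkℚᵘ y e} (*≡* eq)

/-cross⁻¹ : ∀ {x y} d e .{{_ : NonZero d}} .{{_ : NonZero e}} → x ℚ./ d ≡ y ℚ./ e → x ℤ.* + e ≡ y ℤ.* + d
/-cross⁻¹ {x} {y} (suc d) (suc e) eq with ℚP.fromℚᵘ-injective {mkℚᵘ x d} {mkℚᵘ y e} eq
... | *≡* eq′ = eq′

ι : ℤ → ℚ
ι x = x ℚ./ 1

ι-+ : ∀ x y → ι (x ℤ.+ y) ≡ ι x ℚ.+ ι y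
ι-+ x y = trans (/-cross {x ℤ.+ y} {x ℤ.* 1ℤ ℤ.+ y ℤ.* 1ℤ} 1 1 (expand x y)) (fromℚᵘ-+ (mkℚᵘ x 0) (mkℚᵘ y 0))
  where
  expand : ∀ x y → (x ℤ.+ y) ℤ.* 1ℤ ≡ (x ℤ.* 1ℤ ℤ.+ y ℤ.* 1ℤ) ℤ.* 1ℤ
  expand = solve-∀

ι-* : ∀ x y → ι (x ℤ.* y) ≡ ι x ℚ.* ι y
ι-* x y = fromℚᵘ-* (mkℚᵘ x 0) (mkℚᵘ y 0)

ι-neg : ∀ x → ι (ℤ.- x) ≡ ℚ.- ι x
ι-neg x = fromℚᵘ-neg (mkℚᵘ x 0)

/-as-ι : ∀ x d .{{_ : NonZero d}} → x ℚ./ d ≡ ι x ℚ.* (1ℤ ℚ./ d)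
/-as-ι x d@(suc d-1) = trans (/-cross {x} {x ℤ.* 1ℤ} d (1 * d) eq) (fromℚᵘ-* (mkℚᵘ x 0) (mkℚᵘ 1ℤ d-1))
  where
  eq : x ℤ.* + (1 * d) ≡ x ℤ.* 1ℤ ℤ.* + d
  eq = trans (cong (λ k → x ℤ.* + k) (ℕP.*-identityˡ d)) (cong (ℤ._* + d) (sym (ℤP.*-identityʳ x)))

/-+ι : ∀ x y d .{{_ : NonZero d}} → (x ℤ.+ + d ℤ.* y) ℚ./ d ≡ x ℚ./ d ℚ.+ ι y
/-+ι x y d@(suc d-1) = trans (/-cross {x ℤ.+ + d ℤ.* y} {x ℤ.* 1ℤ ℤ.+ y ℤ.* + d} d (d * 1) eq)
                             (fromℚᵘ-+ (mkℚᵘ x d-1) (mkℚᵘ y 0))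
  where
  rearrange : ∀ x y D → (x ℤ.+ D ℤ.* y) ℤ.* D ≡ (x ℤ.* 1ℤ ℤ.+ y ℤ.* D) ℤ.* D
  rearrange = solve-∀
  eq : (x ℤ.+ + d ℤ.* y) ℤ.* + (d * 1) ≡ (x ℤ.* 1ℤ ℤ.+ y ℤ.* + d) ℤ.* + d
  eq = trans (cong (λ k → (x ℤ.+ + d ℤ.* y) ℤ.* + k) (ℕP.*-identityʳ d)) (rearrange x y (+ d))

floor-≃ : ∀ p n d → ℚ.toℚᵘ p ℚᵘ.≃ mkℚᵘ (+ n) d → floor p ≡ + (n / suc d)
floor-≃ (ℚ.mkℚ (+ N) e _) n d (*≡* eq) = trans (ℤP.*-identityˡ (+ (N / suc e))) (cong +_ (begin
  N / suc e                    ≡⟨ sym (ℕD.m*n/o*n≡m/o N (suc d) (suc e)) ⟩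
  N * suc d / (suc e * suc d)  ≡⟨ ℕD./-congˡ {o = suc e * suc d} cross ⟩
  n * suc e / (suc e * suc d)  ≡⟨ ℕD./-congʳ {m = n * suc e} (ℕP.*-comm (suc e) (suc d)) ⟩
  n * suc e / (suc d * suc e)  ≡⟨ ℕD.m*n/o*n≡m/o n (suc e) (suc d) ⟩
  n / suc d                    ∎))
  where
  cross : N * suc d ≡ n * suc e
  cross = ℤP.+-injective (trans (ℤP.pos-* N (suc d)) (trans eq (sym (ℤP.pos-* n (suc e)))))
floor-≃ (ℚ.mkℚ -[1+ N ] e _) n d (*≡* eq) with trans eq (sym (ℤP.pos-* n (suc e)))
... | ()

floor-/ : ∀ n d .{{_ : NonZero d}} → floor (+ n ℚ./ d) ≡ + (n / d)
floor-/ n (suc d) = floor-≃ (+ n ℚ./ suc d) n d (ℚP.toℚᵘ-fromℚᵘ (mkℚᵘ (+ n) d))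

frac-/ : ∀ n d .{{_ : NonZero d}} → frac (+ n ℚ./ d) ≡ + (n % d) ℚ./ d
frac-/ n d = begin
  + n ℚ./ d ℚ.- floor (+ n ℚ./ d) ℚ./ 1          ≡⟨ cong₂ (λ u v → u ℚ./ d ℚ.- v ℚ./ 1) n≡r+dq (floor-/ n d) ⟩
  (r ℤ.+ + d ℤ.* q) ℚ./ d ℚ.- ι q                 ≡⟨ cong (ℚ._- ι q) (/-+ι r q d) ⟩
  r ℚ./ d ℚ.+ ι q ℚ.- ι q                         ≡⟨ ℚP.+-assoc (r ℚ./ d) (ι q) (ℚ.- ι q) ⟩
  r ℚ./ d ℚ.+ (ι q ℚ.- ι q)                       ≡⟨ cong (ℚ._+_ (r ℚ./ d)) (ℚP.+-inverseʳ (ι q)) ⟩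
  r ℚ./ d ℚ.+ ℚ.0ℚ                                ≡⟨ ℚP.+-identityʳ (r ℚ./ d) ⟩
  r ℚ./ d                                         ∎
  where
  r = + (n % d)
  q = + (n / d)
  cancel : ∀ x y → x ℤ.- y ℤ.+ y ≡ x
  cancel = solve-∀
  n≡r+dq : + n ≡ r ℤ.+ + d ℤ.* q
  n≡r+dq = trans (sym (cancel (+ n) (+ d ℤ.* q))) (cong (ℤ._+ + d ℤ.* q) (sym (pos-% n d)))

saw-0 : ∀ x → frac x ≡ ℚ.0ℚ → saw x ≡ ℚ.0ℚ
saw-0 x fx≡0 = cong (λ b → if b then ℚ.0ℚ else frac x ℚ.- ½) (dec-true (frac x ℚ.≟ ℚ.0ℚ) fx≡0)

saw-≢0 : ∀ x → frac x ≢ ℚ.0ℚ → saw x ≡ frac x ℚ.- ½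
saw-≢0 x fx≢0 = cong (λ b → if b then ℚ.0ℚ else frac x ℚ.- ½) (dec-false (frac x ℚ.≟ ℚ.0ℚ) fx≢0)

saw-/ : ∀ n d .{{_ : NonZero d}} → saw (+ n ℚ./ d) ≡ ι (sawℤ d n) ℚ.* (1ℤ ℚ./ (2 * d)) {{ℕP.m*n≢0 2 d}}
saw-/ n d@(suc d-1) with d ∣? n
... | yes d∣n = begin
  saw (+ n ℚ./ d)                    ≡⟨ saw-0 (+ n ℚ./ d) (trans (frac-/ n d) (trans (cong (λ r → + r ℚ./ d) (ℕDiv.n∣m⇒m%n≡0 n d d∣n))
                                                                                      (ℚP.0/n≡0 d))) ⟩
  ℚ.0ℚ                               ≡⟨ sym (ℚP.*-zeroˡ (1ℤ ℚ./ (2 * d))) ⟩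
  ι 0ℤ ℚ.* (1ℤ ℚ./ (2 * d))          ≡⟨ cong (λ s → ι s ℚ.* (1ℤ ℚ./ (2 * d))) (sym (sawℤ-∣ d n d∣n)) ⟩
  ι (sawℤ d n) ℚ.* (1ℤ ℚ./ (2 * d))  ∎
... | no d∤n = begin
  saw (+ n ℚ./ d)                                  ≡⟨ saw-≢0 (+ n ℚ./ d) (λ eq → r/d≢0 (trans (sym (frac-/ n d)) eq)) ⟩
  frac (+ n ℚ./ d) ℚ.- ½                           ≡⟨ cong (ℚ._- ½) (frac-/ n d) ⟩
  r ℚ./ d ℚ.- ½                                    ≡⟨ cong (ℚ._+_ (r ℚ./ d)) (sym (fromℚᵘ-neg (mkℚᵘ 1ℤ 1))) ⟩
  r ℚ./ d ℚ.+ ℚ.fromℚᵘ (ℚᵘ.- mkℚᵘ 1ℤ 1)            ≡⟨ sym (fromℚᵘ-+ (mkℚᵘ r d-1) (ℚᵘ.- mkℚᵘ 1ℤ 1)) ⟩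
  (r ℤ.* + 2 ℤ.+ ℤ.- 1ℤ ℤ.* + d) ℚ./ (d * 2)       ≡⟨ /-cross {r ℤ.* + 2 ℤ.+ ℤ.- 1ℤ ℤ.* + d} {+ 2 ℤ.* r ℤ.- + d} (d * 2) (2 * d) cross ⟩
  (+ 2 ℤ.* r ℤ.- + d) ℚ./ (2 * d)                  ≡⟨ /-as-ι (+ 2 ℤ.* r ℤ.- + d) (2 * d) ⟩
  ι (+ 2 ℤ.* r ℤ.- + d) ℚ.* (1ℤ ℚ./ (2 * d))       ≡⟨ cong (λ s → ι s ℚ.* (1ℤ ℚ./ (2 * d))) (sym (sawℤ-∤ d n d∤n)) ⟩
  ι (sawℤ d n) ℚ.* (1ℤ ℚ./ (2 * d))                ∎
  where
  r = + (n % d)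
  r/d≢0 : r ℚ./ d ≢ ℚ.0ℚ
  r/d≢0 eq = d∤n (ℕDiv.m%n≡0⇒n∣m n d (ℤP.+-injective (trans (sym (ℤP.*-identityʳ r)) (/-cross⁻¹ {r} {0ℤ} d 1 eq))))
  algebra : ∀ R D → (R ℤ.* + 2 ℤ.+ ℤ.- 1ℤ ℤ.* D) ℤ.* (+ 2 ℤ.* D) ≡ (+ 2 ℤ.* R ℤ.- D) ℤ.* (D ℤ.* + 2)
  algebra = solve-∀
  cross : (r ℤ.* + 2 ℤ.+ ℤ.- 1ℤ ℤ.* + d) ℤ.* + (2 * d) ≡ (+ 2 ℤ.* r ℤ.- + d) ℤ.* + (d * 2)
  cross = begin
    (r ℤ.* + 2 ℤ.+ ℤ.- 1ℤ ℤ.* + d) ℤ.* + (2 * d)      ≡⟨ cong (ℤ._*_ (r ℤ.* + 2 ℤ.+ ℤ.- 1ℤ ℤ.* + d)) (ℤP.pos-* 2 d) ⟩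
    (r ℤ.* + 2 ℤ.+ ℤ.- 1ℤ ℤ.* + d) ℤ.* (+ 2 ℤ.* + d)  ≡⟨ algebra r (+ d) ⟩
    (+ 2 ℤ.* r ℤ.- + d) ℤ.* (+ d ℤ.* + 2)            ≡⟨ cong (ℤ._*_ (+ 2 ℤ.* r ℤ.- + d)) (sym (ℤP.pos-* d 2)) ⟩
    (+ 2 ℤ.* r ℤ.- + d) ℤ.* + (d * 2)                ∎

negOnePow-ε : ∀ n → negOnePow (+ n) ≡ ι (ε n)
negOnePow-ε n = trans (parity (n % 2) (ℕD.m%n<n n 2)) (cong ι (sym (ε-%2 n)))
  where
  parity : ∀ k → k < 2 → (if k ℕ.≡ᵇ 0 then ℚ.1ℚ else ℚ.- ℚ.1ℚ) ≡ ι (ε k)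
  parity 0             _ = refl
  parity 1             _ = refl
  parity (suc (suc k)) (ℕ.s≤s (ℕ.s≤s ()))

sumTo-ι : ∀ n (f : ℕ → ℚ) (g : ℕ → ℤ) k → (∀ r → f r ≡ ι (g r) ℚ.* k) → sumTo n f ≡ ι (Σ n g) ℚ.* k
sumTo-ι n f g k f≡ = trans (cong (foldr ℚ._+_ ℚ.0ℚ) (map-upTo f n)) (foldr-applyUpTo n f g f≡)
  where
  foldr-applyUpTo : ∀ n f g → (∀ r → f r ≡ ι (g r) ℚ.* k) → foldr ℚ._+_ ℚ.0ℚ (applyUpTo f n) ≡ ι (Σ n g) ℚ.* k
  foldr-applyUpTo zero    f g f≡ = sym (ℚP.*-zeroˡ k)
  foldr-applyUpTo (suc n) f g f≡ = begin
    f 0 ℚ.+ foldr ℚ._+_ ℚ.0ℚ (applyUpTo (f ∘ suc) n)  ≡⟨ cong₂ ℚ._+_ (f≡ 0) (foldr-applyUpTo n (f ∘ suc) (g ∘ suc) (f≡ ∘ suc)) ⟩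
    ι (g 0) ℚ.* k ℚ.+ ι (Σ n (g ∘ suc)) ℚ.* k         ≡⟨ sym (ℚP.*-distribʳ-+ k (ι (g 0)) (ι (Σ n (g ∘ suc)))) ⟩
    (ι (g 0) ℚ.+ ι (Σ n (g ∘ suc))) ℚ.* k             ≡⟨ cong (ℚ._* k) (sym (ι-+ (g 0) (Σ n (g ∘ suc)))) ⟩
    ι (g 0 ℤ.+ Σ n (g ∘ suc)) ℚ.* k                   ≡⟨ cong (λ x → ι x ℚ.* k) (sym (Σ-head n g)) ⟩
    ι (Σ (suc n) g) ℚ.* k                             ∎

s₅-as-numerator : ∀ e c d → s₅ (+ e) (+ c) (+ suc d) ≡ ι (s₅-numerator e c (suc d)) ℚ.* (1ℤ ℚ./ (2 * suc d))
s₅-as-numerator e c d = sumTo-ι (suc d) _ _ k term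
  where
  D = suc d
  k = 1ℤ ℚ./ (2 * D)
  term : ∀ r → negOnePow (+ r ℤ.+ floor (ratio (+ e ℤ.* + r) (+ D))) ℚ.* saw (ratio (+ c ℤ.* + r) (+ D))
               ≡ ι (ε (r + e * r / D) ℤ.* sawℤ D (c * r)) ℚ.* k
  term r = begin
    negOnePow (+ r ℤ.+ floor ((+ e ℤ.* + r) ℚ./ D)) ℚ.* saw ((+ c ℤ.* + r) ℚ./ D)
      ≡⟨ cong₂ (λ u v → negOnePow (+ r ℤ.+ floor (u ℚ./ D)) ℚ.* saw (v ℚ./ D)) (sym (ℤP.pos-* e r)) (sym (ℤP.pos-* c r)) ⟩
    negOnePow (+ r ℤ.+ floor (+ (e * r) ℚ./ D)) ℚ.* saw (+ (c * r) ℚ./ D)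
      ≡⟨ cong₂ ℚ._*_ (trans (cong (λ t → negOnePow (+ r ℤ.+ t)) (floor-/ (e * r) D)) (negOnePow-ε (r + e * r / D)))
                     (saw-/ (c * r) D) ⟩
    ι (ε (r + e * r / D)) ℚ.* (ι (sawℤ D (c * r)) ℚ.* k)
      ≡⟨ sym (ℚP.*-assoc (ι (ε (r + e * r / D))) (ι (sawℤ D (c * r))) k) ⟩
    ι (ε (r + e * r / D)) ℚ.* ι (sawℤ D (c * r)) ℚ.* k
      ≡⟨ cong (ℚ._* k) (sym (ι-* (ε (r + e * r / D)) (sawℤ D (c * r)))) ⟩
    ι (ε (r + e * r / D) ℤ.* sawℤ D (c * r)) ℚ.* k ∎

sumTo-negOnePow : ∀ a b c →
  sumTo c (λ r → negOnePow (floor (+ (a * suc r) ℚ./ suc c) ℤ.+ floor (+ (b * suc r) ℚ./ suc c)))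
    ≡ ι (Σ c (λ r → ε (a * suc r / suc c + b * suc r / suc c)))
sumTo-negOnePow a b c = trans (sumTo-ι c _ _ ℚ.1ℚ term) (ℚP.*-identityʳ _)
  where
  term : ∀ r → negOnePow (floor (+ (a * suc r) ℚ./ suc c) ℤ.+ floor (+ (b * suc r) ℚ./ suc c))
               ≡ ι (ε (a * suc r / suc c + b * suc r / suc c)) ℚ.* ℚ.1ℚ
  term r = trans (cong₂ (λ u v → negOnePow (u ℤ.+ v)) (floor-/ (a * suc r) (suc c)) (floor-/ (b * suc r) (suc c)))
                 (trans (negOnePow-ε (a * suc r / suc c + b * suc r / suc c)) (sym (ℚP.*-identityʳ _)))

module _ (a b : ℕ) .{{_ : NonZero a}} .{{_ : NonZero b}} where
  private instance
    2a≢0 : NonZero (2 * a)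
    2a≢0 = ℕP.m*n≢0 2 a
    2b≢0 : NonZero (2 * b)
    2b≢0 = ℕP.m*n≢0 2 b
    2ab≢0 : NonZero (2 * a * b)
    2ab≢0 = ℕP.m*n≢0 (2 * a) b

  1/d≡ι[x]/2ab : ∀ x d .{{_ : NonZero d}} → 2 * a * b ≡ x * d → 1ℤ ℚ./ d ≡ ι (+ x) ℚ.* (1ℤ ℚ./ (2 * a * b))
  1/d≡ι[x]/2ab x d 2ab≡xd = trans (/-cross {1ℤ} {+ x} d (2 * a * b) cross) (/-as-ι (+ x) (2 * a * b))
    where
    cross : 1ℤ ℤ.* + (2 * a * b) ≡ + x ℤ.* + d
    cross = trans (ℤP.*-identityˡ _) (trans (cong +_ 2ab≡xd) (ℤP.pos-* x d))

  divide-by-2ab : ∀ X Y T C → + b ℤ.* X ℤ.+ + a ℤ.* Y ≡ + (a * b) ℤ.* (T ℤ.+ 1ℤ) ℤ.- C →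
             ι Y ℚ.* (1ℤ ℚ./ (2 * b)) ℚ.+ ι X ℚ.* (1ℤ ℚ./ (2 * a)) ≡ ½ ℚ.* ι T ℚ.- C ℚ./ (2 * a * b) ℚ.+ ½
  divide-by-2ab X Y T C hyp = begin
    ι Y ℚ.* (1ℤ ℚ./ (2 * b)) ℚ.+ ι X ℚ.* (1ℤ ℚ./ (2 * a))
      ≡⟨ cong₂ (λ u v → ι Y ℚ.* u ℚ.+ ι X ℚ.* v) (1/d≡ι[x]/2ab a (2 * b) (reorder-b a b)) (1/d≡ι[x]/2ab b (2 * a) (reorder-a a b)) ⟩
    ι Y ℚ.* (ι (+ a) ℚ.* h) ℚ.+ ι X ℚ.* (ι (+ b) ℚ.* h)
      ≡⟨ collect (ι Y) (ι X) (ι (+ a)) (ι (+ b)) h ⟩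
    (ι (+ b) ℚ.* ι X ℚ.+ ι (+ a) ℚ.* ι Y) ℚ.* h
      ≡⟨ cong (ℚ._* h) (sym (trans (ι-+ (+ b ℤ.* X) (+ a ℤ.* Y)) (cong₂ ℚ._+_ (ι-* (+ b) X) (ι-* (+ a) Y)))) ⟩
    ι (+ b ℤ.* X ℤ.+ + a ℤ.* Y) ℚ.* h
      ≡⟨ cong (λ z → ι z ℚ.* h) hyp ⟩
    ι (+ (a * b) ℤ.* (T ℤ.+ 1ℤ) ℤ.- C) ℚ.* h
      ≡⟨ cong (ℚ._* h) expand ⟩
    (ι (+ (a * b)) ℚ.* (ι T ℚ.+ ℚ.1ℚ) ℚ.- ι C) ℚ.* h
      ≡⟨ distribute (ι (+ (a * b))) (ι T) (ι C) h ⟩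
    ι (+ (a * b)) ℚ.* h ℚ.* ι T ℚ.- ι C ℚ.* h ℚ.+ ι (+ (a * b)) ℚ.* h
      ≡⟨ cong₂ (λ u v → u ℚ.* ι T ℚ.- v ℚ.+ u) (sym (1/d≡ι[x]/2ab (a * b) 2 (reorder-½ a b))) (sym (/-as-ι C (2 * a * b))) ⟩
    ½ ℚ.* ι T ℚ.- C ℚ./ (2 * a * b) ℚ.+ ½ ∎
    where
    open +-*-Solver
    h = 1ℤ ℚ./ (2 * a * b)
    reorder-b : ∀ a b → 2 * a * b ≡ a * (2 * b)
    reorder-b = ℕ-Solver.solve-∀
    reorder-a : ∀ a b → 2 * a * b ≡ b * (2 * a)
    reorder-a = ℕ-Solver.solve-∀
    reorder-½ : ∀ a b → 2 * a * b ≡ a * b * 2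
    reorder-½ = ℕ-Solver.solve-∀
    expand : ι (+ (a * b) ℤ.* (T ℤ.+ 1ℤ) ℤ.- C) ≡ ι (+ (a * b)) ℚ.* (ι T ℚ.+ ℚ.1ℚ) ℚ.- ι C
    expand = begin
      ι (+ (a * b) ℤ.* (T ℤ.+ 1ℤ) ℤ.- C)          ≡⟨ ι-+ (+ (a * b) ℤ.* (T ℤ.+ 1ℤ)) (ℤ.- C) ⟩
      ι (+ (a * b) ℤ.* (T ℤ.+ 1ℤ)) ℚ.+ ι (ℤ.- C)  ≡⟨ cong₂ ℚ._+_ (trans (ι-* (+ (a * b)) (T ℤ.+ 1ℤ))
                                                                      (cong (ℚ._*_ (ι (+ (a * b)))) (ι-+ T 1ℤ)))
                                                               (ι-neg C) ⟩
      ι (+ (a * b)) ℚ.* (ι T ℚ.+ ℚ.1ℚ) ℚ.- ι C     ∎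
    collect : ∀ y x α β h → y ℚ.* (α ℚ.* h) ℚ.+ x ℚ.* (β ℚ.* h) ≡ (β ℚ.* x ℚ.+ α ℚ.* y) ℚ.* h
    collect = solve 5 (λ y x α β h → y :* (α :* h) :+ x :* (β :* h) := (β :* x :+ α :* y) :* h) refl
    distribute : ∀ A T C h → (A ℚ.* (T ℚ.+ ℚ.1ℚ) ℚ.- C) ℚ.* h ≡ A ℚ.* h ℚ.* T ℚ.- C ℚ.* h ℚ.+ A ℚ.* h
    distribute = solve 4 (λ A T C h → (A :* (T :+ con ℚ.1ℚ) :- C) :* h := A :* h :* T :- C :* h :+ A :* h) refl

corollary1p4 : (a b c : ℕ) → .{{_ : ℕ.NonZero c}} →
    a % 2 ≡ 1 → b % 2 ≡ 1 →
    gcd a b ≡ 1 → gcd b c ≡ 1 → gcd a c ≡ 1 →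
    s₅ (+ a) (+ c) (+ b) ℚ.+ s₅ (+ b) (+ c) (+ a)
      ≡ ½ ℚ.* sumTo (c ∸ 1) (λ r → negOnePow (floor (ratio (+ (a * suc r)) (+ c)) ℤ.+ floor (ratio (+ (b * suc r)) (+ c))))
        ℚ.- ratio (+ c) (+ (2 * a * b)) ℚ.+ ½
corollary1p4 zero    _       _    ()    _     _   _   _
corollary1p4 (suc _) zero    _    _     ()    _   _   _
corollary1p4 (suc _) (suc _) zero _     _     _   _   _ = contradiction refl (ℕ.≢-nonZero⁻¹ 0)
corollary1p4 a@(suc a-1) b@(suc b-1) c@(suc c-1) a-odd b-odd gab gbc gac = begin
  s₅ (+ a) (+ c) (+ b) ℚ.+ s₅ (+ b) (+ c) (+ a)
    ≡⟨ cong₂ ℚ._+_ (s₅-as-numerator a c b-1) (s₅-as-numerator b c a-1) ⟩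
  ι (s₅-numerator a c b) ℚ.* (1ℤ ℚ./ (2 * b)) ℚ.+ ι (s₅-numerator b c a) ℚ.* (1ℤ ℚ./ (2 * a))
    ≡⟨ divide-by-2ab a b (s₅-numerator b c a) (s₅-numerator a c b) T (+ c) reciprocity ⟩
  ½ ℚ.* ι T ℚ.- + c ℚ./ (2 * a * b) ℚ.+ ½
    ≡⟨ cong (λ t → ½ ℚ.* t ℚ.- + c ℚ./ (2 * a * b) ℚ.+ ½) (sym (sumTo-negOnePow a b c-1)) ⟩
  ½ ℚ.* sumTo (c ∸ 1) (λ r → negOnePow (floor (ratio (+ (a * suc r)) (+ c)) ℤ.+ floor (ratio (+ (b * suc r)) (+ c))))
    ℚ.- ratio (+ c) (+ (2 * a * b)) ℚ.+ ½ ∎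
  where
  open Reciprocity a b c a-odd b-odd (gcd≡1⇒coprime gab) (gcd≡1⇒coprime gbc) (gcd≡1⇒coprime gac) using (T; reciprocity)
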